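{- The vertex cover number, the feedback vertex set number, and the odd cycle transversal number are awesome graph parameters; that is, for each $\rho\in\{\mathrm{vc},\mathrm{fvs},\mathrm{oct}\}$, a graph class has clique-bounded $\rho$ if and only if it has bounded $\alpha\text{ - }\rho$.
   Context: All graphs are finite, simple and undirected; $\alpha,\omega$ denote independence and clique number. A graph class is a set of graphs closed under isomorphism. A vertex cover (resp. feedback vertex set, odd cycle transversal) of $G$ is a set $S\subseteq V(G)$ meeting every edge (resp. every cycle, every odd cycle) of $G$; $\mathrm{vc}(G)$, $\mathrm{fvs}(G)$, $\mathrm{oct}(G)$ are the minimum cardinalities of such sets. For each of these parameters $\rho$, the independence variant $\alpha\text{ - }\rho(G)$ is the minimum of $\alpha(G[S])$ over all sets $S$ of the corresponding kind (e.g. $\alpha\text{ - }\mathrm{vc}(G)=\min\{\alpha(G[S]): S \text{ a vertex cover of } G\}$). For a graph parameter $\sigma$, a class $\mathcal G$ has bounded $\sigma$ if there is an integer $k$ with $\sigma(G')\le k$ for every induced subgraph $G'$ of every $G\in\mathcal G$; it has clique-bounded $\sigma$ if there is a nondecreasing $f$ with $\sigma(G')\le f(\omega(G'))$ for all such $G'$. -}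

module Defs where

open import Data.Nat using (ℕ; zero; suc; _+_; _*_; _≤_)
open import Data.Bool using (Bool; true; false)
open import Data.Fin using (Fin; zero; suc; inject₁; fromℕ)
open import Data.Fin.Subset using (Subset; _∈_; _⊆_; ∣_∣)
open import Data.Product using (Σ; ∃; _×_; _,_)
open import Data.Sum using (_⊎_)
open import Relation.Binary.PropositionalEquality using (_≡_; _≢_)
open import Function.Definitions using (Injective)
open import Function.Bundles using (_↔_; Inverse; _⇔_)
open import Level using (0ℓ)

record Graph : Set where
  field
    n     : ℕ
    E     : Fin n → Fin n → Bool
    sym   : ∀ i j → E i j ≡ E j i
    irref : ∀ i → E i i ≡ false
open Graph public

Iso : Graph → Graph → Set
Iso G H = Σ (Fin (n G) ↔ Fin (n H)) λ φ →
  ∀ i j → E H (Inverse.to φ i) (Inverse.to φ j) ≡ E G i j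

GraphClass : Set₁
GraphClass = Graph → Set

ClosedUnderIso : GraphClass → Set
ClosedUnderIso C = ∀ G H → Iso G H → C G → C H

InducedSub : Graph → Graph → Set
InducedSub H G = Σ (Fin (n H) → Fin (n G)) λ f →
  Injective _≡_ _≡_ f × (∀ i j → E G (f i) (f j) ≡ E H i j)

IsClique : (G : Graph) → Subset (n G) → Set
IsClique G K = ∀ i j → i ∈ K → j ∈ K → i ≢ j → E G i j ≡ true

IsIndependent : (G : Graph) → Subset (n G) → Set
IsIndependent G I = ∀ i j → i ∈ I → j ∈ I → E G i j ≡ false

CliqueNumber : Graph → ℕ → Set
CliqueNumber G w = (Σ (Subset (n G)) λ K → IsClique G K × ∣ K ∣ ≡ w)
                 × (∀ K → IsClique G K → ∣ K ∣ ≤ w)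

AlphaInducedLe : (G : Graph) → Subset (n G) → ℕ → Set
AlphaInducedLe G S k = ∀ I → I ⊆ S → IsIndependent G I → ∣ I ∣ ≤ k

record Cycle (G : Graph) : Set where
  field
    m      : ℕ
    c      : Fin (suc (suc (suc m))) → Fin (n G)
    inj    : Injective _≡_ _≡_ c
    step   : ∀ (i : Fin (suc (suc m))) → E G (c (inject₁ i)) (c (suc i)) ≡ true
    close  : E G (c (fromℕ (suc (suc m)))) (c zero) ≡ true
open Cycle public

cycleLength : ∀ {G} → Cycle G → ℕ
cycleLength C = suc (suc (suc (m C)))

Odd : ℕ → Set
Odd k = ∃ λ j → k ≡ suc (2 * j)

Kind : Set₁
Kind = (G : Graph) → Subset (n G) → Set

IsVertexCover : Kind
IsVertexCover G S = ∀ i j → E G i j ≡ true → i ∈ S ⊎ j ∈ S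

IsFVS : Kind
IsFVS G S = ∀ (C : Cycle G) → ∃ λ i → c C i ∈ S

IsOCT : Kind
IsOCT G S = ∀ (C : Cycle G) → Odd (cycleLength C) → ∃ λ i → c C i ∈ S

ParamLe : Kind → Graph → ℕ → Set
ParamLe K G k = Σ (Subset (n G)) λ S → K G S × ∣ S ∣ ≤ k

AlphaParamLe : Kind → Graph → ℕ → Set
AlphaParamLe K G k = Σ (Subset (n G)) λ S → K G S × AlphaInducedLe G S k

CliqueBounded : Kind → GraphClass → Set
CliqueBounded K C = Σ (ℕ → ℕ) λ f → (∀ a b → a ≤ b → f a ≤ f b) ×
  (∀ G H → C G → InducedSub H G → ∀ w → CliqueNumber H w → ParamLe K H (f w))

BoundedAlpha : Kind → GraphClass → Set
BoundedAlpha K C = Σ ℕ λ k → ∀ G H → C G → InducedSub H G → AlphaParamLe K H k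

Awesome : Kind → Set₁
Awesome K = ∀ (C : GraphClass) → ClosedUnderIso C → CliqueBounded K C ⇔ BoundedAlpha K C

-- Deleting a set S of any of the three kinds leaves a triangle-free graph, so S meets every
-- triangle, and such a set for an induced subgraph G[T] lifts to one for G by adding ∁ T.
-- If ρ ≤ f(ω) on the class and a ρ-set S of G contains an independent set J with |J| > f(3),
-- then G[∁ S ∪ J] has clique number at most 3 (a clique meets J in at most one vertex and
-- ∁ S in at most two), hence a ρ-set D with |D| ≤ f(3); lifting D gives a ρ-set of G smaller
-- than S. Repeating from S = V(G) ends with α(G[S]) ≤ f(3). Conversely, a ρ-set S with
-- α(G[S]) ≤ k and ω(G[S]) ≤ w has fewer than R(k + 1, w + 1) vertices by Ramsey's theorem.

module Submission where

open import Defs hiding (sym)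
open import Data.Nat using (ℕ; zero; suc; _+_; _≤_; _<_; z≤n; s≤s; s≤s⁻¹)
open import Data.Nat.Properties
open import Data.Bool using (true; false)
import Data.Bool.Properties as Bool
open import Data.Fin using (Fin; zero; suc; inject≤)
import Data.Fin.Properties as Fin
open import Data.Fin.Subset
open import Data.Fin.Subset.Properties
open import Data.Vec using ([]; _∷_; here; there; tabulate)
open import Data.Vec.Properties using ([]=⇒lookup; lookup⇒[]=; lookup∘tabulate)
open import Data.Product using (Σ; ∃; ∃-syntax; _×_; _,_; proj₁; proj₂)
open import Data.Sum using (_⊎_; inj₁; inj₂; [_,_]′) renaming (map to ⊎-map)
open import Function.Base using (_∘_)
open import Function.Bundles using (mk⇔)
open import Function.Definitions using (Injective)
open import Relation.Nullary using (¬_; Dec; yes; no; contradiction)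
open import Relation.Nullary.Decidable using (_×-dec_; _→-dec_; ¬?)
open import Relation.Binary.PropositionalEquality

enum : ∀ {k} (T : Subset k) → Fin ∣ T ∣ → Fin k
enum (true ∷ T) zero = zero
enum (true ∷ T) (suc i) = suc (enum T i)
enum (false ∷ T) i = suc (enum T i)

enum-injective : ∀ {k} (T : Subset k) → Injective _≡_ _≡_ (enum T)
enum-injective (true ∷ T) {zero} {zero} _ = refl
enum-injective (true ∷ T) {zero} {suc j} ()
enum-injective (true ∷ T) {suc i} {zero} ()
enum-injective (true ∷ T) {suc i} {suc j} eq = cong suc (enum-injective T (Fin.suc-injective eq))
enum-injective (false ∷ T) eq = enum-injective T (Fin.suc-injective eq)

enum-∈ : ∀ {k} (T : Subset k) i → enum T i ∈ T
enum-∈ (true ∷ T) zero = here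
enum-∈ (true ∷ T) (suc i) = there (enum-∈ T i)
enum-∈ (false ∷ T) i = there (enum-∈ T i)

enum-surjective : ∀ {k} (T : Subset k) {x} → x ∈ T → ∃[ i ] enum T i ≡ x
enum-surjective (true ∷ T) here = zero , refl
enum-surjective (true ∷ T) (there x∈T) with enum-surjective T x∈T
... | i , refl = suc i , refl
enum-surjective (false ∷ T) (there x∈T) with enum-surjective T x∈T
... | i , refl = i , refl

image : ∀ {k} (T : Subset k) → Subset ∣ T ∣ → Subset k
image [] [] = []
image (true ∷ T) (b ∷ S) = b ∷ image T S
image (false ∷ T) S = false ∷ image T S

∈-image⁺ : ∀ {k} (T : Subset k) (S : Subset ∣ T ∣) {i} → i ∈ S → enum T i ∈ image T S
∈-image⁺ (true ∷ T) (b ∷ S) here = here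
∈-image⁺ (true ∷ T) (b ∷ S) (there i∈S) = there (∈-image⁺ T S i∈S)
∈-image⁺ (false ∷ T) S i∈S = there (∈-image⁺ T S i∈S)

∈-image⁻ : ∀ {k} (T : Subset k) (S : Subset ∣ T ∣) {x} → x ∈ image T S → ∃[ i ] i ∈ S × enum T i ≡ x
∈-image⁻ (true ∷ T) (b ∷ S) here = zero , here , refl
∈-image⁻ (true ∷ T) (b ∷ S) (there x∈) with ∈-image⁻ T S x∈
... | i , i∈S , refl = suc i , there i∈S , refl
∈-image⁻ (false ∷ T) S (there x∈) with ∈-image⁻ T S x∈
... | i , i∈S , refl = i , i∈S , refl

image⊆ : ∀ {k} (T : Subset k) (S : Subset ∣ T ∣) → image T S ⊆ T
image⊆ T S x∈ with ∈-image⁻ T S x∈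
... | i , _ , refl = enum-∈ T i

∣image∣ : ∀ {k} (T : Subset k) (S : Subset ∣ T ∣) → ∣ image T S ∣ ≡ ∣ S ∣
∣image∣ [] [] = refl
∣image∣ (true ∷ T) (true ∷ S) = cong suc (∣image∣ T S)
∣image∣ (true ∷ T) (false ∷ S) = ∣image∣ T S
∣image∣ (false ∷ T) S = ∣image∣ T S

_↪_ : ∀ {k} → ℕ → Subset k → Set
_↪_ {k} j p = Σ (Fin j → Fin k) λ t → Injective _≡_ _≡_ t × (∀ i → t i ∈ p)

↪-≤∣p∣ : ∀ {k j} (p : Subset k) → j ≤ ∣ p ∣ → j ↪ p
↪-≤∣p∣ p j≤∣p∣ =
  (λ i → enum p (inject≤ i j≤∣p∣)) ,
  (λ eq → Fin.inject≤-injective j≤∣p∣ j≤∣p∣ _ _ (enum-injective p eq)) ,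
  (λ i → enum-∈ p _)

¬↪⇒∣p∣≤ : ∀ {k j} (p : Subset k) → ¬ (suc j ↪ p) → ∣ p ∣ ≤ j
¬↪⇒∣p∣≤ p ¬↪ = ≮⇒≥ (¬↪ ∘ ↪-≤∣p∣ p)

∣p∪q∣≡∣p∣+∣q∣ : ∀ {k} (p q : Subset k) → (∀ {x} → x ∈ p → x ∉ q) → ∣ p ∪ q ∣ ≡ ∣ p ∣ + ∣ q ∣
∣p∪q∣≡∣p∣+∣q∣ [] [] _ = refl
∣p∪q∣≡∣p∣+∣q∣ (true ∷ p) (true ∷ q) disj = contradiction here (disj here)
∣p∪q∣≡∣p∣+∣q∣ (true ∷ p) (false ∷ q) disj =
  cong suc (∣p∪q∣≡∣p∣+∣q∣ p q (λ x∈p x∈q → disj (there x∈p) (there x∈q)))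
∣p∪q∣≡∣p∣+∣q∣ (false ∷ p) (true ∷ q) disj =
  trans (cong suc (∣p∪q∣≡∣p∣+∣q∣ p q (λ x∈p x∈q → disj (there x∈p) (there x∈q)))) (sym (+-suc _ _))
∣p∪q∣≡∣p∣+∣q∣ (false ∷ p) (false ∷ q) disj = ∣p∪q∣≡∣p∣+∣q∣ p q (λ x∈p x∈q → disj (there x∈p) (there x∈q))

∣p∣+∣∁p∣≡n : ∀ {k} (p : Subset k) → ∣ p ∣ + ∣ ∁ p ∣ ≡ k
∣p∣+∣∁p∣≡n {k} p = begin
  ∣ p ∣ + ∣ ∁ p ∣ ≡⟨ ∣p∪q∣≡∣p∣+∣q∣ p (∁ p) x∈p⇒x∉∁p ⟨
  ∣ p ∪ ∁ p ∣     ≡⟨ cong ∣_∣ (p∪∁p≡⊤ p) ⟩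
  ∣ ⊤ {k} ∣       ≡⟨ ∣⊤∣≡n k ⟩
  k               ∎
  where open ≡-Reasoning

∣p∣≡∣p∩q∣+∣p∩∁q∣ : ∀ {k} (p q : Subset k) → ∣ p ∣ ≡ ∣ p ∩ q ∣ + ∣ p ∩ ∁ q ∣
∣p∣≡∣p∩q∣+∣p∩∁q∣ [] [] = refl
∣p∣≡∣p∩q∣+∣p∩∁q∣ (true ∷ p) (true ∷ q) = cong suc (∣p∣≡∣p∩q∣+∣p∩∁q∣ p q)
∣p∣≡∣p∩q∣+∣p∩∁q∣ (true ∷ p) (false ∷ q) =
  trans (cong suc (∣p∣≡∣p∩q∣+∣p∩∁q∣ p q)) (sym (+-suc _ _))
∣p∣≡∣p∩q∣+∣p∩∁q∣ (false ∷ p) (_ ∷ q) = ∣p∣≡∣p∩q∣+∣p∩∁q∣ p q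

∣p∣≡1+∣p-x∣ : ∀ {k} (p : Subset k) {x} → x ∈ p → ∣ p ∣ ≡ suc ∣ p - x ∣
∣p∣≡1+∣p-x∣ (true ∷ p) here = cong (suc ∘ ∣_∣) (sym (p─⊥≡p p))
∣p∣≡1+∣p-x∣ (true ∷ p) (there x∈p) = cong suc (∣p∣≡1+∣p-x∣ p x∈p)
∣p∣≡1+∣p-x∣ (false ∷ p) (there x∈p) = ∣p∣≡1+∣p-x∣ p x∈p

x∉p-x : ∀ {k} (p : Subset k) x → x ∉ p - x
x∉p-x (b ∷ p) (suc x) (there x∈) = x∉p-x p x x∈

∣p∪⁅x⁆∣≡1+∣p∣ : ∀ {k} (p : Subset k) {x} → x ∉ p → ∣ p ∪ ⁅ x ⁆ ∣ ≡ suc ∣ p ∣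
∣p∪⁅x⁆∣≡1+∣p∣ p {x} x∉p = begin
  ∣ p ∪ ⁅ x ⁆ ∣   ≡⟨ ∣p∪q∣≡∣p∣+∣q∣ p ⁅ x ⁆ (λ y∈p y∈⁅x⁆ → x∉p (subst (_∈ p) (x∈⁅y⁆⇒x≡y x y∈⁅x⁆) y∈p)) ⟩
  ∣ p ∣ + ∣ ⁅ x ⁆ ∣ ≡⟨ cong (∣ p ∣ +_) (∣⁅x⁆∣≡1 x) ⟩
  ∣ p ∣ + 1       ≡⟨ +-comm ∣ p ∣ 1 ⟩
  suc ∣ p ∣       ∎
  where open ≡-Reasoning

∣q∣+∣∁[∁p∪q]∣≡∣p∣ : ∀ {k} {p q : Subset k} → q ⊆ p → ∣ q ∣ + ∣ ∁ (∁ p ∪ q) ∣ ≡ ∣ p ∣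
∣q∣+∣∁[∁p∪q]∣≡∣p∣ {k} {p} {q} q⊆p = +-cancelˡ-≡ ∣ ∁ p ∣ _ _ (begin
  ∣ ∁ p ∣ + (∣ q ∣ + ∣ ∁ T ∣) ≡⟨ +-assoc (∣ ∁ p ∣) (∣ q ∣) (∣ ∁ T ∣) ⟨
  (∣ ∁ p ∣ + ∣ q ∣) + ∣ ∁ T ∣ ≡⟨ cong (_+ ∣ ∁ T ∣) (∣p∪q∣≡∣p∣+∣q∣ (∁ p) q (λ x∈∁p → x∈∁p⇒x∉p x∈∁p ∘ q⊆p)) ⟨
  ∣ T ∣ + ∣ ∁ T ∣             ≡⟨ ∣p∣+∣∁p∣≡n T ⟩
  k                           ≡⟨ ∣p∣+∣∁p∣≡n p ⟨
  ∣ p ∣ + ∣ ∁ p ∣             ≡⟨ +-comm (∣ p ∣) (∣ ∁ p ∣) ⟩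
  ∣ ∁ p ∣ + ∣ p ∣             ∎)
  where
  T = ∁ p ∪ q
  open ≡-Reasoning

x∈p⇒⁅x⁆⊆p : ∀ {k} {p : Subset k} {x} → x ∈ p → ⁅ x ⁆ ⊆ p
x∈p⇒⁅x⁆⊆p {x = x} x∈p y∈⁅x⁆ = subst (_∈ _) (sym (x∈⁅y⁆⇒x≡y x y∈⁅x⁆)) x∈p

p∪⁅x⁆⊆q : ∀ {k} {p q : Subset k} {x} → p ⊆ q → x ∈ q → p ∪ ⁅ x ⁆ ⊆ q
p∪⁅x⁆⊆q {p = p} {x = x} p⊆q x∈q y∈ = [ p⊆q , x∈p⇒⁅x⁆⊆p x∈q ]′ (x∈p∪q⁻ p ⁅ x ⁆ y∈)

induced : (G : Graph) → Subset (n G) → Graph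
induced G T = record
  { n = ∣ T ∣
  ; E = λ i j → E G (enum T i) (enum T j)
  ; sym = λ i j → Graph.sym G (enum T i) (enum T j)
  ; irref = λ i → irref G (enum T i)
  }

induced-InducedSub : ∀ G T → InducedSub (induced G T) G
induced-InducedSub G T = enum T , enum-injective T , λ _ _ → refl

InducedSub-trans : ∀ {F H G} → InducedSub F H → InducedSub H G → InducedSub F G
InducedSub-trans (f , f-inj , f-E) (g , g-inj , g-E) =
  g ∘ f , f-inj ∘ g-inj , λ i j → trans (g-E (f i) (f j)) (f-E i j)

no-loop : ∀ G v → E G v v ≢ true
no-loop G v Evv = contradiction (trans (sym (irref G v)) Evv) λ ()

neighbours : (G : Graph) → Fin (n G) → Subset (n G)
neighbours G v = tabulate (E G v)

∈-neighbours⁻ : ∀ G v {x} → x ∈ neighbours G v → E G v x ≡ true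
∈-neighbours⁻ G v {x} x∈ = trans (sym (lookup∘tabulate (E G v) x)) ([]=⇒lookup x∈)

∉-neighbours⁻ : ∀ G v {x} → x ∉ neighbours G v → E G v x ≡ false
∉-neighbours⁻ G v {x} x∉ with E G v x in eq
... | false = refl
... | true = contradiction (lookup⇒[]= x (neighbours G v) (trans (lookup∘tabulate (E G v) x) eq)) x∉

CliqueInducedLe : (G : Graph) → Subset (n G) → ℕ → Set
CliqueInducedLe G S w = ∀ Q → Q ⊆ S → IsClique G Q → ∣ Q ∣ ≤ w

clique-⊆ : ∀ G {Q Q′} → Q′ ⊆ Q → IsClique G Q → IsClique G Q′
clique-⊆ G Q′⊆Q Q-clique i j i∈ j∈ = Q-clique i j (Q′⊆Q i∈) (Q′⊆Q j∈)

⁅⁆-clique : ∀ G v → IsClique G ⁅ v ⁆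
⁅⁆-clique G v i j i∈ j∈ i≢j = contradiction (trans (x∈⁅y⁆⇒x≡y v i∈) (sym (x∈⁅y⁆⇒x≡y v j∈))) i≢j

⁅⁆-independent : ∀ G v → IsIndependent G ⁅ v ⁆
⁅⁆-independent G v i j i∈ j∈ rewrite x∈⁅y⁆⇒x≡y v i∈ | x∈⁅y⁆⇒x≡y v j∈ = irref G v

clique-∪⁅⁆ : ∀ G {Q} v → IsClique G Q → (∀ {x} → x ∈ Q → E G v x ≡ true) → IsClique G (Q ∪ ⁅ v ⁆)
clique-∪⁅⁆ G {Q} v Q-clique v-Q i j i∈ j∈ i≢j with x∈p∪q⁻ Q ⁅ v ⁆ i∈ | x∈p∪q⁻ Q ⁅ v ⁆ j∈
... | inj₁ i∈Q | inj₁ j∈Q = Q-clique i j i∈Q j∈Q i≢j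
... | inj₁ i∈Q | inj₂ j∈⁅v⁆ rewrite x∈⁅y⁆⇒x≡y v j∈⁅v⁆ = trans (Graph.sym G i v) (v-Q i∈Q)
... | inj₂ i∈⁅v⁆ | inj₁ j∈Q rewrite x∈⁅y⁆⇒x≡y v i∈⁅v⁆ = v-Q j∈Q
... | inj₂ i∈⁅v⁆ | inj₂ j∈⁅v⁆ = ⁅⁆-clique G v i j i∈⁅v⁆ j∈⁅v⁆ i≢j

independent-∪⁅⁆ : ∀ G {I} v → IsIndependent G I → (∀ {x} → x ∈ I → E G v x ≡ false) → IsIndependent G (I ∪ ⁅ v ⁆)
independent-∪⁅⁆ G {I} v I-ind v-I i j i∈ j∈ with x∈p∪q⁻ I ⁅ v ⁆ i∈ | x∈p∪q⁻ I ⁅ v ⁆ j∈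
... | inj₁ i∈I | inj₁ j∈I = I-ind i j i∈I j∈I
... | inj₁ i∈I | inj₂ j∈⁅v⁆ rewrite x∈⁅y⁆⇒x≡y v j∈⁅v⁆ = trans (Graph.sym G i v) (v-I i∈I)
... | inj₂ i∈⁅v⁆ | inj₁ j∈I rewrite x∈⁅y⁆⇒x≡y v i∈⁅v⁆ = v-I j∈I
... | inj₂ i∈⁅v⁆ | inj₂ j∈⁅v⁆ = ⁅⁆-independent G v i j i∈⁅v⁆ j∈⁅v⁆

∣clique∩independent∣≤1 : ∀ G {Q I} → IsClique G Q → IsIndependent G I → ∣ Q ∩ I ∣ ≤ 1
∣clique∩independent∣≤1 G {Q} {I} Q-clique I-ind = ¬↪⇒∣p∣≤ (Q ∩ I) λ (t , t-inj , t∈) →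
  let (t₀∈Q , t₀∈I) = x∈p∩q⁻ Q I (t∈ zero)
      (t₁∈Q , t₁∈I) = x∈p∩q⁻ Q I (t∈ (suc zero))
  in contradiction
       (trans (sym (Q-clique _ _ t₀∈Q t₁∈Q (λ eq → contradiction (t-inj eq) λ ()))) (I-ind _ _ t₀∈I t₁∈I))
       λ ()

AlphaInducedLe-drop : ∀ G {S T k} v → v ∈ S → T ⊆ S → v ∉ T → (∀ {x} → x ∈ T → E G v x ≡ false) →
                      AlphaInducedLe G S (suc k) → AlphaInducedLe G T k
AlphaInducedLe-drop G v v∈S T⊆S v∉T v-T α I I⊆T I-ind = s≤s⁻¹ (begin
  suc ∣ I ∣       ≡⟨ ∣p∪⁅x⁆∣≡1+∣p∣ I (v∉T ∘ I⊆T) ⟨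
  ∣ I ∪ ⁅ v ⁆ ∣   ≤⟨ α (I ∪ ⁅ v ⁆) (p∪⁅x⁆⊆q (T⊆S ∘ I⊆T) v∈S) (independent-∪⁅⁆ G v I-ind (v-T ∘ I⊆T)) ⟩
  suc _           ∎)
  where open ≤-Reasoning

CliqueInducedLe-drop : ∀ G {S T w} v → v ∈ S → T ⊆ S → (∀ {x} → x ∈ T → E G v x ≡ true) →
                       CliqueInducedLe G S (suc w) → CliqueInducedLe G T w
CliqueInducedLe-drop G v v∈S T⊆S v-T ω Q Q⊆T Q-clique = s≤s⁻¹ (begin
  suc ∣ Q ∣       ≡⟨ ∣p∪⁅x⁆∣≡1+∣p∣ Q v∉Q ⟨
  ∣ Q ∪ ⁅ v ⁆ ∣   ≤⟨ ω (Q ∪ ⁅ v ⁆) (p∪⁅x⁆⊆q (T⊆S ∘ Q⊆T) v∈S) (clique-∪⁅⁆ G v Q-clique (v-T ∘ Q⊆T)) ⟩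
  suc _           ∎)
  where
  open ≤-Reasoning
  v∉Q : v ∉ Q
  v∉Q = no-loop G v ∘ v-T ∘ Q⊆T

-- ramseyBound k w + 1 is the Erdős–Szekeres bound on the Ramsey number R(k + 1, w + 1).
ramseyBound : ℕ → ℕ → ℕ
ramseyBound zero w = 0
ramseyBound (suc k) zero = 0
ramseyBound (suc k) (suc w) = suc (ramseyBound k (suc w) + ramseyBound (suc k) w)

ramseyBound-mono : ∀ k {a b} → a ≤ b → ramseyBound k a ≤ ramseyBound k b
ramseyBound-mono zero a≤b = z≤n
ramseyBound-mono (suc k) {zero} a≤b = z≤n
ramseyBound-mono (suc k) {suc a} {suc b} a≤b =
  s≤s (+-mono-≤ (ramseyBound-mono k a≤b) (ramseyBound-mono (suc k) (s≤s⁻¹ a≤b)))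

ramsey : ∀ G k w (S : Subset (n G)) → AlphaInducedLe G S k → CliqueInducedLe G S w → ∣ S ∣ ≤ ramseyBound k w
ramsey G k w S α ω with nonempty? S
... | no S-empty = subst (_≤ ramseyBound k w) (sym (trans (cong ∣_∣ (Empty-unique S-empty)) (∣⊥∣≡0 (n G)))) z≤n
ramsey G zero w S α ω | yes (v , v∈S) =
  contradiction (subst (_≤ 0) (∣⁅x⁆∣≡1 v) (α ⁅ v ⁆ (x∈p⇒⁅x⁆⊆p v∈S) (⁅⁆-independent G v))) λ ()
ramsey G (suc k) zero S α ω | yes (v , v∈S) =
  contradiction (subst (_≤ 0) (∣⁅x⁆∣≡1 v) (ω ⁅ v ⁆ (x∈p⇒⁅x⁆⊆p v∈S) (⁅⁆-clique G v))) λ ()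
ramsey G (suc k) (suc w) S α ω | yes (v , v∈S) = begin
  ∣ S ∣                      ≡⟨ ∣p∣≡∣p∩q∣+∣p∩∁q∣ S A ⟩
  ∣ N ∣ + ∣ S ∩ ∁ A ∣        ≡⟨ cong (∣ N ∣ +_) (∣p∣≡1+∣p-x∣ (S ∩ ∁ A) v∈S∩∁A) ⟩
  ∣ N ∣ + suc ∣ M ∣          ≡⟨ +-suc (∣ N ∣) (∣ M ∣) ⟩
  suc (∣ N ∣ + ∣ M ∣)        ≤⟨ s≤s (+-mono-≤ ∣N∣≤ ∣M∣≤) ⟩
  suc (ramseyBound (suc k) w + ramseyBound k (suc w)) ≡⟨ cong suc (+-comm (ramseyBound (suc k) w) _) ⟩
  ramseyBound (suc k) (suc w) ∎
  where
  open ≤-Reasoning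
  A = neighbours G v
  N = S ∩ A
  M = (S ∩ ∁ A) - v
  v∈S∩∁A : v ∈ S ∩ ∁ A
  v∈S∩∁A = x∈p∩q⁺ (v∈S , x∉p⇒x∈∁p (no-loop G v ∘ ∈-neighbours⁻ G v))
  M⊆S∩∁A : M ⊆ S ∩ ∁ A
  M⊆S∩∁A = p─q⊆p (S ∩ ∁ A) ⁅ v ⁆
  ∣N∣≤ : ∣ N ∣ ≤ ramseyBound (suc k) w
  ∣N∣≤ = ramsey G (suc k) w N
    (λ I I⊆N → α I (p∩q⊆p S A ∘ I⊆N))
    (CliqueInducedLe-drop G v v∈S (p∩q⊆p S A) (∈-neighbours⁻ G v ∘ p∩q⊆q S A) ω)
  ∣M∣≤ : ∣ M ∣ ≤ ramseyBound k (suc w)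
  ∣M∣≤ = ramsey G k (suc w) M
    (AlphaInducedLe-drop G v v∈S (p∩q⊆p S (∁ A) ∘ M⊆S∩∁A) (x∉p-x (S ∩ ∁ A) v)
      (∉-neighbours⁻ G v ∘ x∈∁p⇒x∉p ∘ p∩q⊆q S (∁ A) ∘ M⊆S∩∁A) α)
    (λ Q Q⊆M → ω Q (p∩q⊆p S (∁ A) ∘ M⊆S∩∁A ∘ Q⊆M))

clique? : ∀ G Q → Dec (IsClique G Q)
clique? G Q = Fin.all? λ i → Fin.all? λ j →
  i ∈? Q →-dec j ∈? Q →-dec ¬? (i Fin.≟ j) →-dec E G i j Bool.≟ true

independent? : ∀ G I → Dec (IsIndependent G I)
independent? G I = Fin.all? λ i → Fin.all? λ j →
  i ∈? I →-dec j ∈? I →-dec E G i j Bool.≟ false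

largest-subset : ∀ {k} {P : Subset k → Set} → (∀ S → Dec (P S)) → P ⊥ →
                 ∃[ S ] P S × (∀ S′ → P S′ → ∣ S′ ∣ ≤ ∣ S ∣)
largest-subset {k} {P} P? P⊥ = search k (λ S _ → ∣p∣≤n S)
  where
  search : ∀ b → (∀ S → P S → ∣ S ∣ ≤ b) → ∃[ S ] P S × (∀ S′ → P S′ → ∣ S′ ∣ ≤ ∣ S ∣)
  search b ≤b with anySubset? (λ S → P? S ×-dec ∣ S ∣ ≟ b)
  ... | yes (S , pS , ∣S∣≡b) = S , pS , λ S′ pS′ → subst (∣ S′ ∣ ≤_) (sym ∣S∣≡b) (≤b S′ pS′)
  search zero ≤b | no ∄S = contradiction (⊥ , P⊥ , ∣⊥∣≡0 k) ∄S
  search (suc b) ≤b | no ∄S = search b λ S pS → s≤s⁻¹ (≤∧≢⇒< (≤b S pS) λ ∣S∣≡1+b → ∄S (S , pS , ∣S∣≡1+b))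

cliqueNumber : ∀ G → ∃ (CliqueNumber G)
cliqueNumber G with largest-subset (clique? G) (λ _ _ x∈⊥ → contradiction x∈⊥ ∉⊥)
... | Q , Q-clique , largest = ∣ Q ∣ , (Q , Q-clique , refl) , largest

Triangle : Graph → Set
Triangle G = Σ (Fin 3 → Fin (n G)) λ t → Injective _≡_ _≡_ t × (∀ i j → i ≢ j → E G (t i) (t j) ≡ true)

triangle⇒cycle : ∀ {G} → Triangle G → Cycle G
triangle⇒cycle (t , t-inj , t-adj) = record
  { m = 0
  ; c = t
  ; inj = t-inj
  ; step = λ { zero → t-adj _ _ λ () ; (suc zero) → t-adj _ _ λ () }
  ; close = t-adj _ _ λ ()
  }

clique⇒triangle : ∀ G {Q} → IsClique G Q → 3 ↪ Q → Triangle G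
clique⇒triangle G Q-clique (t , t-inj , t∈Q) =
  t , t-inj , λ i j i≢j → Q-clique (t i) (t j) (t∈Q i) (t∈Q j) (i≢j ∘ t-inj)

image-clique : ∀ {G} T {Q} → IsClique (induced G T) Q → IsClique G (image T Q)
image-clique T {Q} Q-clique x y x∈ y∈ x≢y with ∈-image⁻ T Q x∈ | ∈-image⁻ T Q y∈
... | i , i∈Q , refl | j , j∈Q , refl = Q-clique i j i∈Q j∈Q (x≢y ∘ cong (enum T))

restrict-cycle : ∀ {G} T (C : Cycle G) → (∀ i → c C i ∈ T) → Cycle (induced G T)
restrict-cycle {G} T C C⊆T = record
  { m = m C
  ; c = c′
  ; inj = λ eq → inj C (trans (sym (c′-enum _)) (trans (cong (enum T) eq) (c′-enum _)))
  ; step = λ i → trans (cong₂ (E G) (c′-enum _) (c′-enum _)) (step C i)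
  ; close = trans (cong₂ (E G) (c′-enum _) (c′-enum _)) (close C)
  }
  where
  c′ : Fin (cycleLength C) → Fin ∣ T ∣
  c′ i = proj₁ (enum-surjective T (C⊆T i))
  c′-enum : ∀ i → enum T (c′ i) ≡ c C i
  c′-enum i = proj₂ (enum-surjective T (C⊆T i))

cycle-meets-image∪∁ : ∀ {G} T D (C : Cycle G) →
                      (∀ C⊆T → ∃[ i ] c (restrict-cycle T C C⊆T) i ∈ D) → ∃[ i ] c C i ∈ image T D ∪ ∁ T
cycle-meets-image∪∁ T D C meets with Fin.all? (λ i → c C i ∈? T)
... | yes C⊆T = let (i , i∈D) = meets C⊆T in
  i , subst (_∈ image T D ∪ ∁ T) (proj₂ (enum-surjective T (C⊆T i))) (p⊆p∪q (∁ T) (∈-image⁺ T D i∈D))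
... | no C⊈T = let (i , cᵢ∉T) = Fin.¬∀⟶∃¬ _ _ (λ i → c C i ∈? T) C⊈T in
  i , q⊆p∪q (image T D) (∁ T) (x∉p⇒x∈∁p cᵢ∉T)

-- K G S says that G − S lies in a fixed hereditary class without triangles
-- (edgeless graphs, forests, bipartite graphs); only these three consequences are used.
record DeletionToTriangleFree (K : Kind) : Set₁ where
  field
    ⊤-deletes : ∀ G → K G ⊤
    meets-triangle : ∀ {G S} → K G S → (t : Triangle G) → ∃[ i ] proj₁ t i ∈ S
    lift : ∀ G T D → K (induced G T) D → K G (image T D ∪ ∁ T)

vertexCover-deletion : DeletionToTriangleFree IsVertexCover
vertexCover-deletion = record
  { ⊤-deletes = λ _ _ _ _ → inj₁ ∈⊤
  ; meets-triangle = λ vc (_ , _ , t-adj) → [ (zero ,_) , (suc zero ,_) ]′ (vc _ _ (t-adj zero (suc zero) λ ()))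
  ; lift = lift
  }
  where
  lift : ∀ G T D → IsVertexCover (induced G T) D → IsVertexCover G (image T D ∪ ∁ T)
  lift G T D vc x y xy with x ∈? T | y ∈? T
  ... | no x∉T | _ = inj₁ (q⊆p∪q (image T D) (∁ T) (x∉p⇒x∈∁p x∉T))
  ... | yes _ | no y∉T = inj₂ (q⊆p∪q (image T D) (∁ T) (x∉p⇒x∈∁p y∉T))
  ... | yes x∈T | yes y∈T with enum-surjective T x∈T | enum-surjective T y∈T
  ... | i , refl | j , refl =
    ⊎-map (p⊆p∪q (∁ T) ∘ ∈-image⁺ T D) (p⊆p∪q (∁ T) ∘ ∈-image⁺ T D) (vc i j xy)

fvs-deletion : DeletionToTriangleFree IsFVS
fvs-deletion = record
  { ⊤-deletes = λ _ _ → zero , ∈⊤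
  ; meets-triangle = λ fvs t → fvs (triangle⇒cycle t)
  ; lift = λ G T D fvs C → cycle-meets-image∪∁ T D C (fvs ∘ restrict-cycle T C)
  }

oct-deletion : DeletionToTriangleFree IsOCT
oct-deletion = record
  { ⊤-deletes = λ _ _ _ → zero , ∈⊤
  ; meets-triangle = λ oct t → oct (triangle⇒cycle t) (1 , refl)
  ; lift = λ G T D oct C odd → cycle-meets-image∪∁ T D C (λ C⊆T → oct (restrict-cycle T C C⊆T) odd)
  }

module _ {K : Kind} (KD : DeletionToTriangleFree K) where
  open DeletionToTriangleFree KD

  ∣clique-outside∣≤2 : ∀ {G S Q} → K G S → IsClique G Q → (∀ {x} → x ∈ Q → x ∉ S) → ∣ Q ∣ ≤ 2
  ∣clique-outside∣≤2 {G} {S} {Q} kS Q-clique Q∩S≡∅ = ¬↪⇒∣p∣≤ Q λ 3↪Q →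
    let (i , tᵢ∈S) = meets-triangle kS (clique⇒triangle G Q-clique 3↪Q) in
    Q∩S≡∅ (proj₂ (proj₂ 3↪Q) i) tᵢ∈S

  ∣clique⊆∁S∪J∣≤3 : ∀ {G S J Q} → K G S → IsIndependent G J → IsClique G Q → Q ⊆ ∁ S ∪ J → ∣ Q ∣ ≤ 3
  ∣clique⊆∁S∪J∣≤3 {G} {S} {J} {Q} kS J-ind Q-clique Q⊆∁S∪J = begin
    ∣ Q ∣                   ≡⟨ ∣p∣≡∣p∩q∣+∣p∩∁q∣ Q J ⟩
    ∣ Q ∩ J ∣ + ∣ Q ∩ ∁ J ∣ ≤⟨ +-mono-≤ (∣clique∩independent∣≤1 G Q-clique J-ind)
                                (∣clique-outside∣≤2 kS (clique-⊆ G (p∩q⊆p Q (∁ J)) Q-clique) Q∩∁J-avoids-S) ⟩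
    3                       ∎
    where
    open ≤-Reasoning
    Q∩∁J-avoids-S : ∀ {x} → x ∈ Q ∩ ∁ J → x ∉ S
    Q∩∁J-avoids-S x∈ x∈S with x∈p∪q⁻ (∁ S) J (Q⊆∁S∪J (p∩q⊆p Q (∁ J) x∈))
    ... | inj₁ x∈∁S = x∈∁p⇒x∉p x∈∁S x∈S
    ... | inj₂ x∈J = x∈∁p⇒x∉p (p∩q⊆q Q (∁ J) x∈) x∈J

  module _ (f : ℕ → ℕ) (f-mono : ∀ a b → a ≤ b → f a ≤ f b) (G : Graph)
           (bounded : ∀ H → InducedSub H G → ∀ w → CliqueNumber H w → ParamLe K H (f w)) where

    shrink : ∀ {S J} → K G S → J ⊆ S → IsIndependent G J → f 3 < ∣ J ∣ → ∃[ S′ ] K G S′ × ∣ S′ ∣ < ∣ S ∣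
    shrink {S} {J} kS J⊆S J-ind f3<∣J∣ = image T D ∪ ∁ T , lift G T D kD , smaller
      where
      T = ∁ S ∪ J
      ωT = cliqueNumber (induced G T)
      w = proj₁ ωT
      w≤3 : w ≤ 3
      w≤3 = let (Q , Q-clique , ∣Q∣≡w) = proj₁ (proj₂ ωT) in begin
        w               ≡⟨ ∣Q∣≡w ⟨
        ∣ Q ∣           ≡⟨ ∣image∣ T Q ⟨
        ∣ image T Q ∣   ≤⟨ ∣clique⊆∁S∪J∣≤3 kS J-ind (image-clique {G} T Q-clique) (image⊆ T Q) ⟩
        3               ∎
        where open ≤-Reasoning
      deletionT : ParamLe K (induced G T) (f w)
      deletionT = bounded (induced G T) (induced-InducedSub G T) w (proj₂ ωT)
      D = proj₁ deletionT
      kD : K (induced G T) D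
      kD = proj₁ (proj₂ deletionT)
      ∣D∣≤f3 : ∣ D ∣ ≤ f 3
      ∣D∣≤f3 = ≤-trans (proj₂ (proj₂ deletionT)) (f-mono w 3 w≤3)
      smaller : ∣ image T D ∪ ∁ T ∣ < ∣ S ∣
      smaller = begin-strict
        ∣ image T D ∪ ∁ T ∣     ≡⟨ ∣p∪q∣≡∣p∣+∣q∣ (image T D) (∁ T) (x∈p⇒x∉∁p ∘ image⊆ T D) ⟩
        ∣ image T D ∣ + ∣ ∁ T ∣ ≡⟨ cong (_+ ∣ ∁ T ∣) (∣image∣ T D) ⟩
        ∣ D ∣ + ∣ ∁ T ∣         ≤⟨ +-monoˡ-≤ (∣ ∁ T ∣) ∣D∣≤f3 ⟩
        f 3 + ∣ ∁ T ∣           <⟨ +-monoˡ-< (∣ ∁ T ∣) f3<∣J∣ ⟩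
        ∣ J ∣ + ∣ ∁ T ∣         ≡⟨ ∣q∣+∣∁[∁p∪q]∣≡∣p∣ J⊆S ⟩
        ∣ S ∣                   ∎
        where open ≤-Reasoning

    shrink-or-α≤ : ∀ {S} → K G S → (∃[ S′ ] K G S′ × ∣ S′ ∣ < ∣ S ∣) ⊎ AlphaInducedLe G S (f 3)
    shrink-or-α≤ {S} kS with anySubset? (λ J → J ⊆? S ×-dec independent? G J ×-dec f 3 <? ∣ J ∣)
    ... | yes (J , J⊆S , J-ind , f3<∣J∣) = inj₁ (shrink kS J⊆S J-ind f3<∣J∣)
    ... | no ∄J = inj₂ λ I I⊆S I-ind → ≮⇒≥ λ f3<∣I∣ → ∄J (I , I⊆S , I-ind , f3<∣I∣)

    descend : ∀ b S → K G S → ∣ S ∣ ≤ b → AlphaParamLe K G (f 3)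
    descend b S kS ∣S∣≤b with shrink-or-α≤ kS
    ... | inj₂ α≤ = S , kS , α≤
    descend zero S kS ∣S∣≤0 | inj₁ (S′ , kS′ , ∣S′∣<∣S∣) = contradiction (<-≤-trans ∣S′∣<∣S∣ ∣S∣≤0) n≮0
    descend (suc b) S kS ∣S∣≤1+b | inj₁ (S′ , kS′ , ∣S′∣<∣S∣) =
      descend b S′ kS′ (s≤s⁻¹ (<-≤-trans ∣S′∣<∣S∣ ∣S∣≤1+b))

    α-deletion≤f3 : AlphaParamLe K G (f 3)
    α-deletion≤f3 = descend (n G) ⊤ (⊤-deletes G) (∣p∣≤n ⊤)

  cliqueBounded⇒boundedAlpha : ∀ C → CliqueBounded K C → BoundedAlpha K C
  cliqueBounded⇒boundedAlpha C (f , f-mono , bounded) = f 3 , λ G H G∈C H⊆G →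
    α-deletion≤f3 f f-mono H λ H′ H′⊆H → bounded G H′ G∈C (InducedSub-trans {H′} {H} {G} H′⊆H H⊆G)

boundedAlpha⇒cliqueBounded : ∀ K C → BoundedAlpha K C → CliqueBounded K C
boundedAlpha⇒cliqueBounded K C (k , bounded) = ramseyBound k , (λ _ _ → ramseyBound-mono k) ,
  λ G H G∈C H⊆G w ωH → let (S , kS , αS) = bounded G H G∈C H⊆G in
    S , kS , ramsey H k w S αS (λ Q _ Q-clique → proj₂ ωH Q Q-clique)

awesome : ∀ {K} → DeletionToTriangleFree K → Awesome K
awesome KD C _ = mk⇔ (cliqueBounded⇒boundedAlpha KD C) (boundedAlpha⇒cliqueBounded _ C)

corollary5p9 : Awesome IsVertexCover × Awesome IsFVS × Awesome IsOCT
corollary5p9 = awesome vertexCover-deletion , awesome fvs-deletion , awesome oct-deletion
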